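{- Let $H$ be a graph with at least one edge, let $F$ be a complete graph on $f(H)+2$ vertices, and let $u,v$ be two distinct vertices of $F$. Suppose the edges of $F$ are colored (with colors from $\mathbb{N}$) so that $F-\{u,v\}$ is rainbow and the set of all edges between $\{u,v\}$ and $V(F)\setminus\{u,v\}$ forms a rainbow copy of $K_{2,f(H)}$. Then no matter what color is assigned to the edge $uv$, $F$ contains a rainbow copy of $H$ containing the edge $uv$.
   Context: All graphs are finite and simple. A subgraph of an edge-colored graph is rainbow if its edges have pairwise distinct colors. For a family $\mathscr{F}$ of graphs, $\mathrm{ex}(N,\mathscr{F})$ is the maximum number of edges in an $N$-vertex graph containing no member of $\mathscr{F}$ as a subgraph. For a graph $H$, let $\mathscr{H}=\{H-\{x,y\}\colon xy\in E(H)\}$ (deleting the two vertices $x,y$), and let $f(H)$ be the smallest integer $n$ such that for each $N\in\{n-1,n\}$ we have $\mathrm{ex}(N,\mathscr{H})\leq \binom{N}{2}-2N-2$. -}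

module Defs where

open import Data.Nat using (ℕ; zero; suc; _+_; _*_; _∸_; _≤_; _<_)
open import Data.Nat.Combinatorics using (_C_)
open import Data.Fin using (Fin; toℕ; punchIn; punchOut)
open import Data.Nat using (_<ᵇ_)
open import Data.Nat.ListAction using (sum)
open import Data.Bool using (Bool; true; false; _∧_; if_then_else_)
open import Data.List using (List; map; allFin)
open import Data.Product using (Σ; _×_; _,_; ∃)
open import Data.Sum using (_⊎_)
open import Data.Empty using (⊥)
open import Relation.Nullary using (¬_)
open import Relation.Binary.PropositionalEquality using (_≡_; _≢_)
open import Function.Definitions using (Injective)

record Graph (n : ℕ) : Set where
  field
    adj   : Fin n → Fin n → Bool
    sym   : ∀ i j → adj i j ≡ adj j i
    irrefl : ∀ i → adj i i ≡ false
open Graph public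

Edge : ∀ {n} → Graph n → Fin n → Fin n → Set
Edge G i j = adj G i j ≡ true

edgeCount : ∀ {n} → Graph n → ℕ
edgeCount {n} G =
  sum (map (λ i → sum (map (λ j → if adj G i j ∧ (toℕ i <ᵇ toℕ j) then 1 else 0) (allFin n))) (allFin n))

_⊆_ : ∀ {m n} → Graph m → Graph n → Set
_⊆_ {m} {n} H G =
  Σ (Fin m → Fin n) λ φ → Injective _≡_ _≡_ φ × (∀ a b → Edge H a b → Edge G (φ a) (φ b))

delete : ∀ {n} → Graph (suc n) → Fin (suc n) → Graph n
delete G v = record
  { adj = λ i j → adj G (punchIn v i) (punchIn v j)
  ; sym = λ i j → sym G (punchIn v i) (punchIn v j)
  ; irrefl = λ i → irrefl G (punchIn v i) }

delete2 : ∀ {m} → Graph (suc (suc m)) → (x y : Fin (suc (suc m))) → x ≢ y → Graph m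
delete2 H x y x≢y = delete (delete H x) (punchOut x≢y)

ContainsMemberℋ : ∀ {k N} → Graph k → Graph N → Set
ContainsMemberℋ {zero}        H G = ⊥
ContainsMemberℋ {suc zero}    H G = ⊥
ContainsMemberℋ {suc (suc m)} H G =
  Σ (Fin (suc (suc m))) λ x → Σ (Fin (suc (suc m))) λ y →
    Σ (x ≢ y) λ x≢y → Edge H x y × (delete2 H x y x≢y ⊆ G)

-- ex(N, ℋ) ≤ C(N,2) - 2N - 2, i.e. every ℋ-free N-vertex graph has at most that many
-- edges (stated additively to avoid truncated subtraction)
ExBound : ∀ {k} → Graph k → ℕ → Set
ExBound H N = ∀ (G : Graph N) → ¬ ContainsMemberℋ H G → edgeCount G + 2 * N + 2 ≤ N C 2

FCond : ∀ {k} → Graph k → ℕ → Set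
FCond H n = ExBound H (n ∸ 1) × ExBound H n

IsF : ∀ {k} → Graph k → ℕ → Set
IsF H n = FCond H n × (∀ m → m < n → ¬ FCond H m)

SamePair : ∀ {n} → Fin n → Fin n → Fin n → Fin n → Set
SamePair a b c d = (a ≡ c × b ≡ d) ⊎ (a ≡ d × b ≡ c)

RainbowSet : ∀ {N} → (Fin N → Fin N → ℕ) → (Fin N → Fin N → Set) → Set
RainbowSet c E = ∀ a b a' b' → E a b → E a' b' → ¬ SamePair a b a' b' → c a b ≢ c a' b'

InsideEdge : ∀ {N} → Fin N → Fin N → Fin N → Fin N → Set
InsideEdge u v a b = a ≢ b × a ≢ u × a ≢ v × b ≢ u × b ≢ v

CrossEdge : ∀ {N} → Fin N → Fin N → Fin N → Fin N → Set
CrossEdge u v a b = (a ≡ u ⊎ a ≡ v) × b ≢ u × b ≢ v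

RainbowCopyWith : ∀ {k N} → Graph k → (Fin N → Fin N → ℕ) → Fin N → Fin N → Set
RainbowCopyWith {k} {N} H c u v =
  Σ (Fin k → Fin N) λ φ → Injective _≡_ _≡_ φ
    × (∀ a b a' b' → Edge H a b → Edge H a' b' → ¬ SamePair a b a' b' →
         c (φ a) (φ b) ≢ c (φ a') (φ b'))
    × (∃ λ a → ∃ λ b → Edge H a b × SamePair (φ a) (φ b) u v)

{-# OPTIONS --safe #-}
module Submission where

-- Let α be the colour of uv and Y the set of vertices outside {u,v}. The spokes (edges
-- from {u,v} to Y) are rainbow, so at most one w ∈ Y has a spoke of colour α; remove it
-- from Y. Now no spoke to Y has colour α, and |Y| ∈ {f(H) - 1, f(H)}. Call a pair in Y
-- free if its colour is neither α nor that of a spoke to Y. These are 2|Y| + 1 colours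
-- and the pairs in Y are rainbow, so at most 2|Y| + 1 pairs in Y are not free. Hence the
-- graph of free pairs has more than C(|Y|,2) - 2|Y| - 2 edges and, by the definition of
-- f(H), contains H - {x,y} for some edge xy of H. Sending x ↦ u and y ↦ v yields a copy
-- of H whose edges are uv, spokes to Y and free pairs, which have pairwise distinct colours.

open import Defs hiding (sym)
open import Data.Bool using (Bool; true; false; _∧_; _∨_; T; if_then_else_)
open import Data.Bool.Properties using (∧-zeroʳ; ∧-distribʳ-∨; ∨-zeroʳ)
  renaming (_≟_ to _≟ᵇ_)
open import Data.Empty using (⊥-elim)
open import Data.Fin using (Fin; zero; suc; toℕ; punchIn; punchOut)
open import Data.Fin.Properties
  using (any?; all?; punchIn-injective; punchInᵢ≢i; punchIn-punchOut; punchOut-cong; 0≢1+n)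
  renaming (_≟_ to _≟ᶠ_; suc-injective to Fin-suc-injective)
open import Data.List using (List; []; _∷_; _++_; length; map; tabulate; allFin)
open import Data.List.Properties using (length-++; length-tabulate; map-tabulate)
open import Data.List.Membership.Propositional using (_∈_; _∉_)
open import Data.List.Membership.Propositional.Properties using (∈-++⁺ˡ; ∈-++⁺ʳ; ∈-tabulate⁺)
open import Data.List.Relation.Unary.Any using (here; there)
open import Data.Nat using (ℕ; zero; suc; _+_; _*_; _∸_; _≤_; _<_; _<ᵇ_; z≤n; s≤s)
open import Data.Nat.Properties
  using (≤-refl; ≤-reflexive; ≤-trans; +-mono-≤; +-identityʳ; +-comm; <ᵇ⇒<; <⇒≢; <⇒≱; <-asym;
         n<1+n; n≢0⇒n>0; ≮⇒≥; n≤0⇒n≡0; +-0-commutativeMonoid; module ≤-Reasoning)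
  renaming (_≟_ to _≟ⁿ_)
open import Data.List.Membership.DecPropositional _≟ⁿ_ using (_∈?_)
open import Algebra.Properties.CommutativeMonoid.Sum +-0-commutativeMonoid
  using (sum; sum-cong-≗; ∑-distrib-+; sum-replicate-zero)
import Data.Nat.ListAction as List
open import Data.Nat.Combinatorics using (_C_; nC1≡n; nCk+nC[k+1]≡[n+1]C[k+1])
open import Data.Nat.Solver using (module +-*-Solver)
open import Data.Product using (Σ; ∃; _×_; _,_; proj₁; proj₂)
import Data.Product as Product
open import Data.Sum using (_⊎_; inj₁; inj₂)
import Data.Sum as Sum
open import Data.Vec.Functional using (Vector; insertAt)
import Data.Vec.Functional as Vector
open import Data.Vec.Functional.Properties using (insertAt-lookup; insertAt-punchIn)
open import Function using (_∘_; id)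
open import Function.Definitions using (Injective)
open import Relation.Binary.Core using (_⇒_)
open import Relation.Binary.Definitions using (Decidable; Symmetric)
open import Relation.Binary.Construct.Union using (_∪_)
open import Relation.Binary.Construct.Closure.Symmetric using (SymClosure; fwd; bwd)
open import Relation.Binary.PropositionalEquality
  using (_≡_; _≢_; _≗_; refl; sym; trans; cong; cong₂; subst; subst₂; module ≡-Reasoning)
open import Relation.Nullary using (Dec; yes; no; does; ¬_; contradiction)
open import Relation.Nullary.Decidable using (map′; _×-dec_; _⊎-dec_; _→-dec_; ¬?; dec-true; dec-false)

private
  variable
    A B : Set

dec-true⁻¹ : (a? : Dec A) → does a? ≡ true → A
dec-true⁻¹ (yes a) _ = a

does-cong : (a? : Dec A) (b? : Dec B) → (A → B) → (B → A) → does a? ≡ does b?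
does-cong (yes a) b? A→B _ = sym (dec-true b? (A→B a))
does-cong (no ¬a) b? _ B→A = sym (dec-false b? (¬a ∘ B→A))

sum-tabulate : ∀ {n} (f : Fin n → ℕ) → List.sum (tabulate f) ≡ sum f
sum-tabulate {zero} f = refl
sum-tabulate {suc n} f = cong (f zero +_) (sum-tabulate (f ∘ suc))

sum-allFin : ∀ {n} (f : Fin n → ℕ) → List.sum (map f (allFin n)) ≡ sum f
sum-allFin f = trans (cong List.sum (map-tabulate id f)) (sum-tabulate f)

∑-mono-≤ : ∀ {n} {f g : Fin n → ℕ} → (∀ i → f i ≤ g i) → sum f ≤ sum g
∑-mono-≤ {zero} _ = z≤n
∑-mono-≤ {suc n} f≤g = +-mono-≤ (f≤g zero) (∑-mono-≤ (f≤g ∘ suc))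

∑-zero : ∀ {n} {f : Fin n → ℕ} → (∀ i → f i ≡ 0) → sum f ≡ 0
∑-zero {n} f≡0 = trans (sum-cong-≗ f≡0) (sum-replicate-zero n)

∑-ones : ∀ n → sum {n} (λ _ → 1) ≡ n
∑-ones zero = refl
∑-ones (suc n) = cong suc (∑-ones n)

∑-positive : ∀ {n} (f : Fin n → ℕ) → 0 < sum f → ∃ λ i → 0 < f i
∑-positive {suc n} f 0<∑f with f zero ≟ⁿ 0
... | no f₀≢0 = zero , n≢0⇒n>0 f₀≢0
... | yes f₀≡0 =
  let i , 0<fi = ∑-positive (f ∘ suc) (subst (λ k → 0 < k + sum (f ∘ suc)) f₀≡0 0<∑f)
  in suc i , 0<fi

∑-≤1 : ∀ {n} (f : Fin n → ℕ) → (∀ i → f i ≤ 1) → (∀ i j → 0 < f i → 0 < f j → i ≡ j) →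
       sum f ≤ 1
∑-≤1 {zero} _ _ _ = z≤n
∑-≤1 {suc n} f f≤1 unique with f zero ≟ⁿ 0
... | yes f₀≡0 = begin
  f zero + sum (f ∘ suc) ≡⟨ cong (_+ sum (f ∘ suc)) f₀≡0 ⟩
  sum (f ∘ suc)          ≤⟨ ∑-≤1 (f ∘ suc) (f≤1 ∘ suc) unique-suc ⟩
  1                      ∎
  where
  open ≤-Reasoning
  unique-suc : ∀ i j → 0 < f (suc i) → 0 < f (suc j) → i ≡ j
  unique-suc i j p q = Fin-suc-injective (unique (suc i) (suc j) p q)
... | no f₀≢0 = begin
  f zero + sum (f ∘ suc) ≡⟨ cong (f zero +_) (∑-zero rest≡0) ⟩
  f zero + 0             ≡⟨ +-identityʳ (f zero) ⟩
  f zero                 ≤⟨ f≤1 zero ⟩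
  1                      ∎
  where
  open ≤-Reasoning
  rest≡0 : ∀ i → f (suc i) ≡ 0
  rest≡0 i = n≤0⇒n≡0 (≮⇒≥ λ 0<fᵢ → 0≢1+n (sym (unique (suc i) zero 0<fᵢ (n≢0⇒n>0 f₀≢0))))

-- Counting pairs i < j

𝟙 : Bool → ℕ
𝟙 b = if b then 1 else 0

pairCount : ∀ {n} → (Fin n → Fin n → Bool) → ℕ
pairCount b = sum λ i → sum λ j → 𝟙 (b i j ∧ (toℕ i <ᵇ toℕ j))

edgeCount≡pairCount : ∀ {n} (G : Graph n) → edgeCount G ≡ pairCount (adj G)
edgeCount≡pairCount {n} G =
  trans (sum-allFin row) (sum-cong-≗ λ i → sum-allFin λ j → 𝟙 (adj G i j ∧ (toℕ i <ᵇ toℕ j)))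
  where
  row : Fin n → ℕ
  row i = List.sum (map (λ j → 𝟙 (adj G i j ∧ (toℕ i <ᵇ toℕ j))) (allFin n))

pairCount-all : ∀ n → pairCount {n} (λ _ _ → true) ≡ n C 2
pairCount-all zero = refl
pairCount-all (suc n) = begin
  sum {n} (λ _ → 1) + pairCount {n} (λ _ _ → true) ≡⟨ cong₂ _+_ (∑-ones n) (pairCount-all n) ⟩
  n + n C 2                                         ≡⟨ cong (_+ n C 2) (sym (nC1≡n n)) ⟩
  n C 1 + n C 2                                     ≡⟨ nCk+nC[k+1]≡[n+1]C[k+1] n 1 ⟩
  suc n C 2                                         ∎
  where open ≡-Reasoning

pairCount-mono : ∀ {n} {b b′ : Fin n → Fin n → Bool} →
                 (∀ i j → toℕ i < toℕ j → b i j ≡ true → b′ i j ≡ true) →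
                 pairCount b ≤ pairCount b′
pairCount-mono b⇒b′ = ∑-mono-≤ λ i → ∑-mono-≤ λ j → 𝟙-∧-mono (b⇒b′ i j ∘ <ᵇ⇒< _ _)
  where
  𝟙-∧-mono : ∀ {a a′ t} → (T t → a ≡ true → a′ ≡ true) → 𝟙 (a ∧ t) ≤ 𝟙 (a′ ∧ t)
  𝟙-∧-mono {false} _ = z≤n
  𝟙-∧-mono {true} {a′} {false} _ rewrite ∧-zeroʳ a′ = z≤n
  𝟙-∧-mono {true} {a′} {true} a⇒a′ rewrite a⇒a′ _ refl = ≤-refl

pairCount-∨ : ∀ {n} {b b′ : Fin n → Fin n → Bool} →
              pairCount (λ i j → b i j ∨ b′ i j) ≤ pairCount b + pairCount b′
pairCount-∨ {b = b} {b′} = begin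
  pairCount (λ i j → b i j ∨ b′ i j)
    ≤⟨ ∑-mono-≤ (λ i → ∑-mono-≤ λ j → 𝟙-∨-∧ (b i j) (b′ i j) _) ⟩
  sum (λ i → sum λ j → entry b i j + entry b′ i j)
    ≡⟨ sum-cong-≗ (λ i → ∑-distrib-+ (entry b i) (entry b′ i)) ⟩
  sum (λ i → sum (entry b i) + sum (entry b′ i))
    ≡⟨ ∑-distrib-+ (sum ∘ entry b) (sum ∘ entry b′) ⟩
  pairCount b + pairCount b′
    ∎
  where
  open ≤-Reasoning
  entry : (Fin _ → Fin _ → Bool) → Fin _ → Fin _ → ℕ
  entry b i j = 𝟙 (b i j ∧ (toℕ i <ᵇ toℕ j))
  𝟙-∨ : ∀ a a′ → 𝟙 (a ∨ a′) ≤ 𝟙 a + 𝟙 a′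
  𝟙-∨ false a′ = ≤-refl
  𝟙-∨ true a′ = s≤s z≤n
  𝟙-∨-∧ : ∀ a a′ t → 𝟙 ((a ∨ a′) ∧ t) ≤ 𝟙 (a ∧ t) + 𝟙 (a′ ∧ t)
  𝟙-∨-∧ a a′ t rewrite ∧-distribʳ-∨ t a a′ = 𝟙-∨ (a ∧ t) (a′ ∧ t)

pairCount-≤1 : ∀ {n} {b : Fin n → Fin n → Bool} →
               (∀ {i j i′ j′} → toℕ i < toℕ j → toℕ i′ < toℕ j′ →
                  b i j ≡ true → b i′ j′ ≡ true → i ≡ i′ × j ≡ j′) →
               pairCount b ≤ 1
pairCount-≤1 {b = b} unique =
  ∑-≤1 (λ i → sum (entry i)) row≤1 λ i i′ p q →
    let j , pj = ∑-positive (entry i) p ; j′ , pj′ = ∑-positive (entry i′) q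
    in proj₁ (unique-entry pj pj′)
  where
  entry : Fin _ → Fin _ → ℕ
  entry i j = 𝟙 (b i j ∧ (toℕ i <ᵇ toℕ j))
  𝟙-∧-positive : ∀ a t → 0 < 𝟙 (a ∧ t) → a ≡ true × T t
  𝟙-∧-positive true true _ = refl , _
  unique-entry : ∀ {i j i′ j′} → 0 < entry i j → 0 < entry i′ j′ → i ≡ i′ × j ≡ j′
  unique-entry {i} {j} {i′} {j′} p q =
    let bij , i<j = 𝟙-∧-positive _ _ p ; bij′ , i′<j′ = 𝟙-∧-positive _ _ q
    in unique (<ᵇ⇒< _ _ i<j) (<ᵇ⇒< _ _ i′<j′) bij bij′
  𝟙≤1 : ∀ a → 𝟙 a ≤ 1
  𝟙≤1 true = ≤-refl
  𝟙≤1 false = z≤n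
  row≤1 : ∀ i → sum (entry i) ≤ 1
  row≤1 i = ∑-≤1 (entry i) (λ j → 𝟙≤1 _) λ j j′ p q → proj₂ (unique-entry p q)

pairCount-∈ : ∀ {n} (col : Fin n → Fin n → ℕ) →
              (∀ {i j i′ j′} → toℕ i < toℕ j → toℕ i′ < toℕ j′ →
                 col i j ≡ col i′ j′ → i ≡ i′ × j ≡ j′) →
              ∀ L → pairCount (λ i j → does (col i j ∈? L)) ≤ length L
pairCount-∈ {n} col _ [] = ≤-reflexive (∑-zero {n} λ i → ∑-zero {n} λ j → refl)
pairCount-∈ col col-injective (l ∷ L) =
  ≤-trans (pairCount-∨ {b = λ i j → does (col i j ≟ⁿ l)})
          (+-mono-≤ (pairCount-≤1 unique) (pairCount-∈ col col-injective L))
  where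
  unique : ∀ {i j i′ j′} → toℕ i < toℕ j → toℕ i′ < toℕ j′ →
           does (col i j ≟ⁿ l) ≡ true → does (col i′ j′ ≟ⁿ l) ≡ true → i ≡ i′ × j ≡ j′
  unique {i} {j} {i′} {j′} i<j i′<j′ p q =
    col-injective i<j i′<j′ (trans (dec-true⁻¹ (col i j ≟ⁿ l) p) (sym (dec-true⁻¹ (col i′ j′ ≟ⁿ l) q)))

graphOf : ∀ {n} {R : Fin n → Fin n → Set} → Decidable R → Symmetric R → (∀ i → ¬ R i i) → Graph n
graphOf R? R-sym R-irrefl = record
  { adj    = λ i j → does (R? i j)
  ; sym    = λ i j → does-cong (R? i j) (R? j i) R-sym R-sym
  ; irrefl = λ i → dec-false (R? i i) (R-irrefl i)
  }

Edge-irrefl : ∀ {n} (G : Graph n) {i : Fin n} → ¬ Edge G i i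
Edge-irrefl G {i} e = contradiction (trans (sym e) (irrefl G i)) λ ()

any-map? : ∀ {m n} {P : (Fin m → Fin n) → Set} → (∀ {f g} → f ≗ g → P f → P g) →
           (∀ f → Dec (P f)) → Dec (∃ P)
any-map? {zero} {n} resp P? = map′ (empty ,_) (λ (f , p) → resp (λ ()) p) (P? empty)
  where
  empty : Fin 0 → Fin n
  empty ()
any-map? {suc m} resp P? =
  map′ (λ (a , f , p) → a Vector.∷ f , p)
       (λ (f , p) → Vector.head f , Vector.tail f , resp (λ { zero → refl ; (suc i) → refl }) p)
       (any? λ a → any-map? (λ f≗g → resp λ { zero → refl ; (suc i) → f≗g i }) (P? ∘ (a Vector.∷_)))

_⊆?_ : ∀ {m n} (G : Graph m) (G′ : Graph n) → Dec (G ⊆ G′)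
_⊆?_ {m} {n} G G′ = any-map? respects λ φ → injective? φ ×-dec preserves? φ
  where
  injective? : (φ : Fin m → Fin n) → Dec (Injective _≡_ _≡_ φ)
  injective? φ = map′ (λ h {x} {y} → h x y) (λ h x y → h)
                      (all? λ x → all? λ y → (φ x ≟ᶠ φ y) →-dec (x ≟ᶠ y))
  preserves? : (φ : Fin m → Fin n) → Dec (∀ a b → Edge G a b → Edge G′ (φ a) (φ b))
  preserves? φ = all? λ a → all? λ b → (adj G a b ≟ᵇ true) →-dec (adj G′ (φ a) (φ b) ≟ᵇ true)
  respects : ∀ {φ ψ} → φ ≗ ψ →
             Injective _≡_ _≡_ φ × (∀ a b → Edge G a b → Edge G′ (φ a) (φ b)) →
             Injective _≡_ _≡_ ψ × (∀ a b → Edge G a b → Edge G′ (ψ a) (ψ b))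
  respects φ≗ψ (φ-inj , φ-edge) =
    (λ {x} {y} eq → φ-inj (trans (φ≗ψ x) (trans eq (sym (φ≗ψ y))))) ,
    λ a b e → subst₂ (Edge G′) (φ≗ψ a) (φ≗ψ b) (φ-edge a b e)

containsMemberℋ? : ∀ {k N} (H : Graph k) (G : Graph N) → Dec (ContainsMemberℋ H G)
containsMemberℋ? {zero} H G = no λ ()
containsMemberℋ? {suc zero} H G = no λ ()
containsMemberℋ? {suc (suc m)} H G = any? λ x → any? λ y → member? x y
  where
  member? : ∀ x y → Dec (Σ (x ≢ y) λ x≢y → Edge H x y × delete2 H x y x≢y ⊆ G)
  member? x y with x ≟ᶠ y
  ... | yes x≡y = no λ (x≢y , _) → x≢y x≡y
  -- The witness may carry another proof of x ≢ y; delete2 sees it only through punchOut.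
  ... | no x≢y =
    map′ (x≢y ,_)
         (λ (x≢y′ , e , φ) → e , subst (_⊆ G) (cong (delete (delete H x)) (punchOut-cong x refl)) φ)
         ((adj H x y ≟ᵇ true) ×-dec (delete2 H x y x≢y ⊆? G))

punchIn-cover : ∀ {n} (i j : Fin (suc n)) → j ≡ i ⊎ ∃ λ k → punchIn i k ≡ j
punchIn-cover i j with j ≟ᶠ i
... | yes j≡i = inj₁ j≡i
... | no j≢i = inj₂ (punchOut (j≢i ∘ sym) , punchIn-punchOut (j≢i ∘ sym))

module _ {n} {xs : Vector A n} {v : A} (k : Fin (suc n)) where

  insertAt-≢ : ∀ {w} → v ≢ w → (∀ i → xs i ≢ w) → ∀ z → insertAt xs k v z ≢ w
  insertAt-≢ v≢w xs≢w z with punchIn-cover k z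
  ... | inj₁ refl = v≢w ∘ trans (sym (insertAt-lookup xs k v))
  ... | inj₂ (j , refl) = xs≢w j ∘ trans (sym (insertAt-punchIn xs k v j))

  insertAt-injective : Injective _≡_ _≡_ xs → (∀ i → xs i ≢ v) → Injective _≡_ _≡_ (insertAt xs k v)
  insertAt-injective xs-inj xs≢v {z} {z′} eq with punchIn-cover k z | punchIn-cover k z′
  ... | inj₁ refl | inj₁ refl = refl
  ... | inj₁ refl | inj₂ (j , refl) =
    ⊥-elim (xs≢v j (trans (sym (insertAt-punchIn xs k v j)) (trans (sym eq) (insertAt-lookup xs k v))))
  ... | inj₂ (i , refl) | inj₁ refl =
    ⊥-elim (xs≢v i (trans (sym (insertAt-punchIn xs k v i)) (trans eq (insertAt-lookup xs k v))))
  ... | inj₂ (i , refl) | inj₂ (j , refl) =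
    cong (punchIn k) (xs-inj (trans (sym (insertAt-punchIn xs k v i)) (trans eq (insertAt-punchIn xs k v j))))

module _ {m} {x y : Fin (suc (suc m))} (x≢y : x ≢ y) where

  punchIn₂ : Fin m → Fin (suc (suc m))
  punchIn₂ = punchIn x ∘ punchIn (punchOut x≢y)

  punchIn₂-injective : Injective _≡_ _≡_ punchIn₂
  punchIn₂-injective = punchIn-injective (punchOut x≢y) _ _ ∘ punchIn-injective x _ _

  punchIn₂ᵢ≢x : ∀ i → punchIn₂ i ≢ x
  punchIn₂ᵢ≢x i = punchInᵢ≢i x _

  punchIn₂ᵢ≢y : ∀ i → punchIn₂ i ≢ y
  punchIn₂ᵢ≢y i eq =
    punchInᵢ≢i (punchOut x≢y) i (punchIn-injective x _ _ (trans eq (sym (punchIn-punchOut x≢y))))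

  punchIn₂-cover : ∀ z → z ≡ x ⊎ z ≡ y ⊎ ∃ λ i → punchIn₂ i ≡ z
  punchIn₂-cover z with punchIn-cover x z
  ... | inj₁ z≡x = inj₁ z≡x
  ... | inj₂ (z′ , refl) with punchIn-cover (punchOut x≢y) z′
  ...   | inj₁ refl = inj₂ (inj₁ (punchIn-punchOut x≢y))
  ...   | inj₂ (i , refl) = inj₂ (inj₂ (i , refl))

  insertAt₂ : Vector A m → A → A → Vector A (suc (suc m))
  insertAt₂ ψ a b = insertAt (insertAt ψ (punchOut x≢y) b) x a

  module _ {ψ : Vector A m} {a b : A} where

    insertAt₂-x : insertAt₂ ψ a b x ≡ a
    insertAt₂-x = insertAt-lookup _ x a

    insertAt₂-y : insertAt₂ ψ a b y ≡ b
    insertAt₂-y = begin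
      insertAt₂ ψ a b y                              ≡⟨ cong (insertAt₂ ψ a b) (sym (punchIn-punchOut x≢y)) ⟩
      insertAt₂ ψ a b (punchIn x (punchOut x≢y))     ≡⟨ insertAt-punchIn _ x a _ ⟩
      insertAt ψ (punchOut x≢y) b (punchOut x≢y)     ≡⟨ insertAt-lookup ψ (punchOut x≢y) b ⟩
      b                                              ∎
      where open ≡-Reasoning

    insertAt₂-punchIn₂ : ∀ i → insertAt₂ ψ a b (punchIn₂ i) ≡ ψ i
    insertAt₂-punchIn₂ i = trans (insertAt-punchIn _ x a _) (insertAt-punchIn ψ (punchOut x≢y) b i)

    insertAt₂-injective : Injective _≡_ _≡_ ψ → a ≢ b → (∀ i → ψ i ≢ a) → (∀ i → ψ i ≢ b) →
                          Injective _≡_ _≡_ (insertAt₂ ψ a b)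
    insertAt₂-injective ψ-inj a≢b ψ≢a ψ≢b =
      insertAt-injective x (insertAt-injective (punchOut x≢y) ψ-inj ψ≢b)
                           (insertAt-≢ (punchOut x≢y) (a≢b ∘ sym) ψ≢a)

SamePair-swapˡ : ∀ {n} {a b a′ b′ : Fin n} → SamePair a b a′ b′ → SamePair b a a′ b′
SamePair-swapˡ (inj₁ (a≡a′ , b≡b′)) = inj₂ (b≡b′ , a≡a′)
SamePair-swapˡ (inj₂ (a≡b′ , b≡a′)) = inj₁ (b≡a′ , a≡b′)

SamePair-swapʳ : ∀ {n} {a b a′ b′ : Fin n} → SamePair a b a′ b′ → SamePair a b b′ a′
SamePair-swapʳ (inj₁ same) = inj₂ same
SamePair-swapʳ (inj₂ same) = inj₁ same

module _ {N} (c : Fin N → Fin N → ℕ) where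

  rainbow-⇒ : ∀ {E E′} → E′ ⇒ E → RainbowSet c E → RainbowSet c E′
  rainbow-⇒ E′⇒E rainbow a b a′ b′ e e′ = rainbow a b a′ b′ (E′⇒E e) (E′⇒E e′)

  rainbow-∪ : ∀ {E₁ E₂} → RainbowSet c E₁ → RainbowSet c E₂ →
              (∀ {a b a′ b′} → E₁ a b → E₂ a′ b′ → c a b ≢ c a′ b′) →
              RainbowSet c (E₁ ∪ E₂)
  rainbow-∪ rainbow₁ _ _ a b a′ b′ (inj₁ e) (inj₁ e′) = rainbow₁ a b a′ b′ e e′
  rainbow-∪ _ _ apart _ _ _ _ (inj₁ e) (inj₂ e′) _ = apart e e′
  rainbow-∪ _ _ apart _ _ _ _ (inj₂ e) (inj₁ e′) _ = apart e′ e ∘ sym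
  rainbow-∪ _ rainbow₂ _ a b a′ b′ (inj₂ e) (inj₂ e′) = rainbow₂ a b a′ b′ e e′

  rainbow-SymClosure : (∀ a b → c a b ≡ c b a) → ∀ {E} → RainbowSet c E → RainbowSet c (SymClosure E)
  rainbow-SymClosure c-sym rainbow a b a′ b′ (fwd e) (fwd e′) ¬same =
    rainbow a b a′ b′ e e′ ¬same
  rainbow-SymClosure c-sym rainbow a b a′ b′ (fwd e) (bwd e′) ¬same eq =
    rainbow a b b′ a′ e e′ (¬same ∘ SamePair-swapʳ) (trans eq (c-sym a′ b′))
  rainbow-SymClosure c-sym rainbow a b a′ b′ (bwd e) (fwd e′) ¬same eq =
    rainbow b a a′ b′ e e′ (¬same ∘ SamePair-swapˡ) (trans (c-sym b a) eq)
  rainbow-SymClosure c-sym rainbow a b a′ b′ (bwd e) (bwd e′) ¬same eq =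
    rainbow b a b′ a′ e e′ (¬same ∘ SamePair-swapʳ ∘ SamePair-swapˡ)
            (trans (c-sym b a) (trans eq (c-sym a′ b′)))

  rainbow-image : ∀ {k} {H : Graph k} {Φ : Fin k → Fin N} {E} → Injective _≡_ _≡_ Φ →
                  RainbowSet c E → (∀ {a b} → Edge H a b → E (Φ a) (Φ b)) →
                  ∀ a b a′ b′ → Edge H a b → Edge H a′ b′ → ¬ SamePair a b a′ b′ →
                  c (Φ a) (Φ b) ≢ c (Φ a′) (Φ b′)
  rainbow-image Φ-inj rainbow into a b a′ b′ e e′ ¬same =
    rainbow _ _ _ _ (into e) (into e′) (¬same ∘ Sum.map (Product.map Φ-inj Φ-inj) (Product.map Φ-inj Φ-inj))

-- Free pairs

record Outside {M} (u v : Fin M) (N : ℕ) : Set where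
  field
    vertex    : Fin N → Fin M
    injective : Injective _≡_ _≡_ vertex
    vertex≢u  : ∀ i → vertex i ≢ u
    vertex≢v  : ∀ i → vertex i ≢ v

outside-all : ∀ {n M} → M ≡ suc (suc n) → {u v : Fin M} → u ≢ v → Outside u v n
outside-all refl u≢v = record
  { vertex = punchIn₂ u≢v ; injective = punchIn₂-injective u≢v
  ; vertex≢u = punchIn₂ᵢ≢x u≢v ; vertex≢v = punchIn₂ᵢ≢y u≢v }

Outside-remove : ∀ {M n} {u v : Fin M} → (O : Outside u v n) → (w : Fin n) →
                 Σ (Outside u v (n ∸ 1)) λ O′ → ∀ i → Outside.vertex O′ i ≢ Outside.vertex O w
Outside-remove {n = suc n} O w =
  record { vertex = vertex ∘ punchIn w ; injective = punchIn-injective w _ _ ∘ injective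
         ; vertex≢u = vertex≢u ∘ punchIn w ; vertex≢v = vertex≢v ∘ punchIn w } ,
  λ i → punchInᵢ≢i w i ∘ injective
  where open Outside O

module _ {M} (c : Fin M → Fin M → ℕ) (c-sym : ∀ a b → c a b ≡ c b a)
         {u v : Fin M} (u≢v : u ≢ v)
         (inside : RainbowSet c (InsideEdge u v)) (cross : RainbowSet c (CrossEdge u v)) where

  SpokesAvoidUV : ∀ {N} → Outside u v N → Set
  SpokesAvoidUV O = ∀ {a} → a ≡ u ⊎ a ≡ v → ∀ i → c a (Outside.vertex O i) ≢ c u v

  module FreePairs {N} (O : Outside u v N) (spokes-avoid : SpokesAvoidUV O) where
    open Outside O

    colour : Fin N → Fin N → ℕ
    colour s t = c (vertex s) (vertex t)

    reserved : List ℕ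
    reserved = c u v ∷ (tabulate (c u ∘ vertex) ++ tabulate (c v ∘ vertex))

    reserved-length : length reserved ≡ suc (N + N)
    reserved-length = cong suc (trans (length-++ (tabulate (c u ∘ vertex)))
                                      (cong₂ _+_ (length-tabulate (c u ∘ vertex)) (length-tabulate (c v ∘ vertex))))

    Free : Fin N → Fin N → Set
    Free s t = s ≢ t × colour s t ∉ reserved

    free? : Decidable Free
    free? s t = ¬? (s ≟ᶠ t) ×-dec ¬? (colour s t ∈? reserved)

    free-graph : Graph N
    free-graph = graphOf free? (λ (s≢t , ∉) → s≢t ∘ sym , ∉ ∘ subst (_∈ reserved) (c-sym _ _))
                         (λ s (s≢s , _) → s≢s refl)

    free-edge : ∀ {s t} → Edge free-graph s t → Free s t
    free-edge {s} {t} = dec-true⁻¹ (free? s t)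

    inside-edge : ∀ {s t} → s ≢ t → InsideEdge u v (vertex s) (vertex t)
    inside-edge s≢t = s≢t ∘ injective , vertex≢u _ , vertex≢v _ , vertex≢u _ , vertex≢v _

    colour-injective : ∀ {s t s′ t′} → toℕ s < toℕ t → toℕ s′ < toℕ t′ →
                       colour s t ≡ colour s′ t′ → s ≡ s′ × t ≡ t′
    colour-injective {s} {t} {s′} {t′} s<t s′<t′ eq with (s ≟ᶠ s′) ×-dec (t ≟ᶠ t′)
    ... | yes same = same
    ... | no different = ⊥-elim (inside _ _ _ _ (inside-edge (<⇒≢ s<t ∘ cong toℕ))
                                                 (inside-edge (<⇒≢ s′<t′ ∘ cong toℕ)) ¬same eq)
      where
      ¬same : ¬ SamePair (vertex s) (vertex t) (vertex s′) (vertex t′)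
      ¬same (inj₁ (p , q)) = different (injective p , injective q)
      ¬same (inj₂ (p , q)) with injective p | injective q
      ... | refl | refl = <-asym s<t s′<t′

    free-or-reserved : ∀ s t → toℕ s < toℕ t →
                       adj free-graph s t ∨ does (colour s t ∈? reserved) ≡ true
    free-or-reserved s t s<t = by-cases (colour s t ∈? reserved)
      where
      by-cases : Dec (colour s t ∈ reserved) → adj free-graph s t ∨ does (colour s t ∈? reserved) ≡ true
      by-cases (yes ∈) = trans (cong (adj free-graph s t ∨_) (dec-true (colour s t ∈? reserved) ∈))
                               (∨-zeroʳ (adj free-graph s t))
      by-cases (no ∉) = cong (_∨ does (colour s t ∈? reserved))
                             (dec-true (free? s t) (<⇒≢ s<t ∘ cong toℕ , ∉))

    many-free-pairs : N C 2 ≤ edgeCount free-graph + length reserved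
    many-free-pairs = begin
      N C 2
        ≡⟨ sym (pairCount-all N) ⟩
      pairCount {N} (λ _ _ → true)
        ≤⟨ pairCount-mono (λ s t s<t _ → free-or-reserved s t s<t) ⟩
      pairCount (λ s t → adj free-graph s t ∨ does (colour s t ∈? reserved))
        ≤⟨ pairCount-∨ {b = adj free-graph} ⟩
      pairCount (adj free-graph) + pairCount (λ s t → does (colour s t ∈? reserved))
        ≤⟨ +-mono-≤ (≤-reflexive (sym (edgeCount≡pairCount free-graph)))
                    (pairCount-∈ colour colour-injective reserved) ⟩
      edgeCount free-graph + length reserved
        ∎
      where open ≤-Reasoning

    contains-member : ∀ {k} (H : Graph k) → ExBound H N → ContainsMemberℋ H free-graph
    contains-member H ex with containsMemberℋ? H free-graph
    ... | yes member = member
    ... | no ℋ-free = ⊥-elim (<⇒≱ too-few-edges (ex free-graph ℋ-free))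
      where
      open ≤-Reasoning
      e : ℕ
      e = edgeCount free-graph
      too-few-edges : N C 2 < e + 2 * N + 2
      too-few-edges = begin-strict
        N C 2                  ≤⟨ many-free-pairs ⟩
        e + length reserved    ≡⟨ cong (e +_) reserved-length ⟩
        e + suc (N + N)        <⟨ n<1+n _ ⟩
        suc (e + suc (N + N))  ≡⟨ solve 2 (λ e N → con 1 :+ (e :+ (con 1 :+ (N :+ N)))
                                                := e :+ con 2 :* N :+ con 2) refl e N ⟩
        e + 2 * N + 2          ∎
        where open +-*-Solver

    UV Spoke Inner Host : Fin M → Fin M → Set
    UV A B = A ≡ u × B ≡ v
    Spoke A B = (A ≡ u ⊎ A ≡ v) × ∃ λ t → B ≡ vertex t
    Inner A B = ∃ λ s → ∃ λ t → A ≡ vertex s × B ≡ vertex t × Edge free-graph s t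
    Host = SymClosure ((UV ∪ Spoke) ∪ Inner)

    host-rainbow : RainbowSet c Host
    host-rainbow =
      rainbow-SymClosure c c-sym
        (rainbow-∪ c (rainbow-∪ c uv-rainbow (rainbow-⇒ c spoke⇒cross cross) uv-spoke-apart)
                     (rainbow-⇒ c inner⇒inside inside) reserved-inner-apart)
      where
      uv-rainbow : RainbowSet c UV
      uv-rainbow _ _ _ _ (refl , refl) (refl , refl) ¬same = ⊥-elim (¬same (inj₁ (refl , refl)))
      spoke⇒cross : Spoke ⇒ CrossEdge u v
      spoke⇒cross (hub , t , refl) = hub , vertex≢u t , vertex≢v t
      inner⇒inside : Inner ⇒ InsideEdge u v
      inner⇒inside (s , t , refl , refl , st) = inside-edge (proj₁ (free-edge st))
      uv-spoke-apart : ∀ {A B A′ B′} → UV A B → Spoke A′ B′ → c A B ≢ c A′ B′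
      uv-spoke-apart (refl , refl) (hub , t , refl) = spokes-avoid hub t ∘ sym
      reserved-colour : ∀ {A B} → (UV ∪ Spoke) A B → c A B ∈ reserved
      reserved-colour (inj₁ (refl , refl)) = here refl
      reserved-colour (inj₂ (inj₁ refl , t , refl)) = there (∈-++⁺ˡ (∈-tabulate⁺ t))
      reserved-colour (inj₂ (inj₂ refl , t , refl)) = there (∈-++⁺ʳ (tabulate (c u ∘ vertex)) (∈-tabulate⁺ t))
      reserved-inner-apart : ∀ {A B A′ B′} → (UV ∪ Spoke) A B → Inner A′ B′ → c A B ≢ c A′ B′
      reserved-inner-apart e (s , t , refl , refl , st) eq =
        proj₂ (free-edge st) (subst (_∈ reserved) eq (reserved-colour e))

    copy : ∀ {k} (H : Graph k) → ContainsMemberℋ H free-graph → RainbowCopyWith H c u v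
    copy {suc (suc m)} H (x , y , x≢y , xy , φ , φ-injective , φ-edge) =
      Φ , Φ-injective , rainbow-image c {H = H} Φ-injective host-rainbow into-host , x , y , xy ,
      inj₁ (Φ-x , Φ-y)
      where
      Φ : Fin (suc (suc m)) → Fin M
      Φ = insertAt₂ x≢y (vertex ∘ φ) u v
      Φ-injective : Injective _≡_ _≡_ Φ
      Φ-injective = insertAt₂-injective x≢y (φ-injective ∘ injective) u≢v (vertex≢u ∘ φ) (vertex≢v ∘ φ)
      Φ-x : Φ x ≡ u
      Φ-x = insertAt₂-x x≢y
      Φ-y : Φ y ≡ v
      Φ-y = insertAt₂-y x≢y
      Φ-π : ∀ i → Φ (punchIn₂ x≢y i) ≡ vertex (φ i)
      Φ-π = insertAt₂-punchIn₂ x≢y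
      into-host : ∀ {a b} → Edge H a b → Host (Φ a) (Φ b)
      into-host {a} {b} ab with punchIn₂-cover x≢y a | punchIn₂-cover x≢y b
      ... | inj₁ refl               | inj₁ refl               = ⊥-elim (Edge-irrefl H ab)
      ... | inj₁ refl               | inj₂ (inj₁ refl)        = fwd (inj₁ (inj₁ (Φ-x , Φ-y)))
      ... | inj₁ refl               | inj₂ (inj₂ (j , refl))  = fwd (inj₁ (inj₂ (inj₁ Φ-x , φ j , Φ-π j)))
      ... | inj₂ (inj₁ refl)        | inj₁ refl               = bwd (inj₁ (inj₁ (Φ-x , Φ-y)))
      ... | inj₂ (inj₁ refl)        | inj₂ (inj₁ refl)        = ⊥-elim (Edge-irrefl H ab)
      ... | inj₂ (inj₁ refl)        | inj₂ (inj₂ (j , refl))  = fwd (inj₁ (inj₂ (inj₂ Φ-y , φ j , Φ-π j)))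
      ... | inj₂ (inj₂ (i , refl))  | inj₁ refl               = bwd (inj₁ (inj₂ (inj₁ Φ-x , φ i , Φ-π i)))
      ... | inj₂ (inj₂ (i , refl))  | inj₂ (inj₁ refl)        = bwd (inj₁ (inj₂ (inj₂ Φ-y , φ i , Φ-π i)))
      ... | inj₂ (inj₂ (i , refl))  | inj₂ (inj₂ (j , refl))  =
        fwd (inj₂ (φ i , φ j , Φ-π i , Φ-π j , φ-edge i j ab))

  spoke-colours-differ : ∀ {a b z w} → CrossEdge u v a z → CrossEdge u v b w → z ≢ w → c a z ≢ c b w
  spoke-colours-differ {a} {b} {z} {w} az@(a-hub , _) bw@(_ , w≢u , w≢v) z≢w = cross _ _ _ _ az bw ¬same
    where
    ¬same : ¬ SamePair a z b w
    ¬same (inj₁ (_ , z≡w)) = z≢w z≡w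
    ¬same (inj₂ (a≡w , _)) =
      Sum.[ (λ a≡u → w≢u (trans (sym a≡w) a≡u)) , (λ a≡v → w≢v (trans (sym a≡w) a≡v)) ] a-hub

  rainbowCopy : ∀ {k} (H : Graph k) {n} → Outside u v n → FCond H n → RainbowCopyWith H c u v
  rainbowCopy H {n} O (ex-pred , ex) = by-cases (any? clash?)
    where
    open Outside O
    Clash : Fin n → Set
    Clash i = c u (vertex i) ≡ c u v ⊎ c v (vertex i) ≡ c u v
    clash? : ∀ i → Dec (Clash i)
    clash? i = (c u (vertex i) ≟ⁿ c u v) ⊎-dec (c v (vertex i) ≟ⁿ c u v)
    by-cases : Dec (∃ Clash) → RainbowCopyWith H c u v
    by-cases (no no-clash) = FreePairs.copy O avoid H (FreePairs.contains-member O avoid H ex)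
      where
      avoid : SpokesAvoidUV O
      avoid (inj₁ refl) i eq = no-clash (i , inj₁ eq)
      avoid (inj₂ refl) i eq = no-clash (i , inj₂ eq)
    by-cases (yes (w , clash)) = FreePairs.copy O′ avoid H (FreePairs.contains-member O′ avoid H ex-pred)
      where
      O′ : Outside u v (n ∸ 1)
      O′ = proj₁ (Outside-remove O w)
      avoid : SpokesAvoidUV O′
      avoid a-hub i eq = Sum.[ differ (inj₁ refl) , differ (inj₂ refl) ] clash
        where
        differ : ∀ {b} → b ≡ u ⊎ b ≡ v → c b (vertex w) ≢ c u v
        differ b-hub e = spoke-colours-differ (a-hub , Outside.vertex≢u O′ i , Outside.vertex≢v O′ i)
                                              (b-hub , vertex≢u w , vertex≢v w)
                                              (proj₂ (Outside-remove O w) i) (trans eq (sym e))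

lemma2p2 : ∀ {k} (H : Graph k) → (∃ λ x → ∃ λ y → Edge H x y) →
    ∀ (n : ℕ) → IsF H n →
    ∀ (c : Fin (n + 2) → Fin (n + 2) → ℕ) → (∀ a b → c a b ≡ c b a) →
    ∀ (u v : Fin (n + 2)) → u ≢ v →
    RainbowSet c (InsideEdge u v) →
    RainbowSet c (CrossEdge u v) →
    RainbowCopyWith H c u v
lemma2p2 H _ n (f-cond , _) c c-sym u v u≢v inside cross =
  rainbowCopy c c-sym u≢v inside cross H (outside-all (+-comm n 2) u≢v) f-cond
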